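{- Let $R$ be a finite commutative ring with unity having an odd number of elements, and suppose $R = R_1 \times \cdots \times R_m$ is a direct product of $m$ finite local rings, where $M_i$ denotes the unique maximal ideal of $R_i$. Then \[ m + \prod_{i=1}^m \left( \frac{|R_i| - |M_i|}{2} \right) = \omega(\mathcal{U}(R_1 \times \cdots \times R_m)) = \chi(\mathcal{U}(R_1 \times \cdots \times R_m)). \]
   Context: For a finite ring $R$ with unity and unit group $R^*$, the unitary addition Cayley graph $\mathcal{U}(R)$ is the simple graph with vertex set $R$ in which distinct vertices $x,y$ are adjacent if and only if $x+y \in R^*$. A local ring is a commutative ring with unity having a unique maximal ideal. $\omega(G)$ denotes the clique number and $\chi(G)$ the chromatic number of a graph $G$. -}

module Defs where

open import Level using (0ℓ)
import Level
open import Algebra.Bundles using (CommutativeRing)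
import Algebra.Construct.DirectProduct as DP
import Algebra.Construct.Terminal as Term
open import Data.Nat using (ℕ; zero; suc; _≤_)
import Data.Nat as ℕ
open import Data.Fin using (Fin)
import Data.Fin as Fin
open import Data.List using (List; length)
open import Data.List.Relation.Unary.All using (All)
open import Data.List.Relation.Unary.Any using (Any)
open import Data.List.Relation.Unary.AllPairs using (AllPairs)
open import Data.Product using (Σ; ∃; _×_; _,_)
open import Data.Sum using (_⊎_)
open import Data.Unit using (⊤; tt)
open import Relation.Nullary using (¬_)
open import Relation.Binary.PropositionalEquality using (_≡_; _≢_)
open import Function.Bundles using (_⇔_)

trivialRing : CommutativeRing 0ℓ 0ℓ
trivialRing = record
  { isCommutativeRing = record
    { isRing = Ring.isRing Term.ring
    ; *-comm = λ _ _ → Level.lift tt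
    }
  }
  where open import Algebra.Bundles using (Ring)

-- R₀ × R₁ × ⋯ × R_{m-1}, built as R₀ × (R₁ × (⋯ × (R_{m-1} × 0)))
-- with componentwise operations (a ring canonically isomorphic to the
-- direct product).
ΠRing : (m : ℕ) → (Fin m → CommutativeRing 0ℓ 0ℓ) → CommutativeRing 0ℓ 0ℓ
ΠRing zero    R = trivialRing
ΠRing (suc m) R = DP.commutativeRing (R Fin.zero) (ΠRing m (λ i → R (Fin.suc i)))

∏ : (m : ℕ) → (Fin m → ℕ) → ℕ
∏ zero    f = 1
∏ (suc m) f = f Fin.zero ℕ.* ∏ m (λ i → f (Fin.suc i))

module _ (R : CommutativeRing 0ℓ 0ℓ) where
  open CommutativeRing R

  IsUnit : Carrier → Set
  IsUnit x = ∃ λ y → x * y ≈ 1#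

  record IsIdeal (I : Carrier → Set) : Set where
    field
      resp     : ∀ {x y} → x ≈ y → I x → I y
      zero∈    : I 0#
      +-closed : ∀ {x y} → I x → I y → I (x + y)
      *-closed : ∀ r {x} → I x → I (r * x)

  IsMaximalIdeal : (Carrier → Set) → Set₁
  IsMaximalIdeal M =
    IsIdeal M × ¬ M 1# ×
    (∀ (J : Carrier → Set) → IsIdeal J → (∀ x → M x → J x) →
       J 1# ⊎ (∀ x → J x → M x))

  IsLocalRing : Set₁
  IsLocalRing =
    Σ (Carrier → Set) λ M → IsMaximalIdeal M ×
      (∀ (J : Carrier → Set) → IsMaximalIdeal J → ∀ x → (J x ⇔ M x))

  HasSize : (Carrier → Set) → ℕ → Set
  HasSize P k =
    Σ (List Carrier) λ xs →
      length xs ≡ k × AllPairs (λ x y → ¬ x ≈ y) xs × All P xs ×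
      (∀ x → P x → Any (x ≈_) xs)

  Card : ℕ → Set
  Card k = HasSize (λ _ → ⊤) k

  -- The unitary addition Cayley graph U(R): vertex set R, distinct x, y
  -- adjacent iff x + y is a unit.

  UAdj : Carrier → Carrier → Set
  UAdj x y = ¬ x ≈ y × IsUnit (x + y)

  IsClique : List Carrier → Set
  IsClique xs = AllPairs UAdj xs

  IsCliqueNumber : ℕ → Set
  IsCliqueNumber k =
    (Σ (List Carrier) λ xs → IsClique xs × length xs ≡ k) ×
    (∀ (xs : List Carrier) → IsClique xs → length xs ≤ k)

  IsProperColouring : (j : ℕ) → (Carrier → Fin j) → Set
  IsProperColouring j c =
    (∀ x y → x ≈ y → c x ≡ c y) × (∀ x y → UAdj x y → c x ≢ c y)

  IsChromaticNumber : ℕ → Set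
  IsChromaticNumber k =
    (Σ (Carrier → Fin k) λ c → IsProperColouring k c) ×
    (∀ (j : ℕ) (c : Carrier → Fin j) → IsProperColouring j c → k ≤ j)

-- Because |R| is odd, 2 is a unit in every factor: otherwise R has an element t ≠ 0 with
-- t + t = 0, and x ↦ x + t splits R into pairs. In a local ring Rᵢ in which 2 is a unit,
-- x ↦ - x pairs off the cosets of Mᵢ other than Mᵢ itself, so choosing coset by coset one of
-- x and - x for every unit x gives a set Hᵢ of (|Rᵢ| - |Mᵢ|)/2 units any two of which, equal
-- or not, have a unit sum. Colouring x by the first i with xᵢ ∈ Mᵢ, and otherwise by the
-- tuple of the elements of the Hᵢ equal to ± xᵢ, is a proper colouring with m + ∏ |Hᵢ|
-- colours. The m elements with 0 in one coordinate and a fixed element of Hⱼ in every other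
-- coordinate j, together with the elements of ∏ Hᵢ, form a clique of the same size.

module Submission where

open import Defs
open import Level using (0ℓ)
open import Algebra.Bundles using (CommutativeRing)
import Algebra.Construct.DirectProduct as DP
open import Data.Nat using (ℕ; zero; suc; _≤_; z≤n; s≤s; _%_; _∸_; ⌊_/2⌋)
import Data.Nat.DivMod as DivMod
import Data.Nat as ℕ
import Data.Nat.Properties as ℕₚ
open import Data.Fin as Fin
  using (Fin; zero; suc; punchOut; _<_; _↑ˡ_; _↑ʳ_; splitAt; join; combine; remQuot)
import Data.Fin.Properties as Finₚ
open import Data.List using (List; []; _∷_; length; lookup; filter; map; _++_; allFin)
open import Data.List.Properties using (length-++; length-map; length-tabulate)
open import Data.List.Membership.Propositional.Properties using (∈-allFin)
open import Data.List.Relation.Unary.All as All using (All; []; _∷_)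
import Data.List.Relation.Unary.All.Properties as All
open import Data.List.Relation.Unary.Any using (index; here)
open import Data.List.Relation.Unary.Any.Properties using (lookup-index)
open import Data.List.Relation.Unary.AllPairs as AllPairs using ([]; _∷_)
import Data.List.Relation.Unary.AllPairs.Properties as AllPairs
open import Data.List.Relation.Unary.Unique.Setoid using (Unique)
import Data.List.Relation.Unary.Unique.Setoid.Properties as Unique
import Data.List.Membership.Setoid as Membership
import Data.List.Membership.Setoid.Properties as Membershipₚ
open import Data.Product using (Σ; ∃; ∃₂; _×_; _,_; proj₁; proj₂)
open import Data.Sum using (_⊎_; inj₁; inj₂; [_,_]′)
open import Data.Empty using (⊥; ⊥-elim)
open import Data.Unit using (⊤; tt)
open import Relation.Binary.Bundles using (Setoid)
open import Relation.Binary.Definitions using (_Respects_; tri<; tri≈; tri>)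
open import Relation.Binary.PropositionalEquality as ≡ using (_≡_; _≢_; refl; cong; cong₂; subst; subst₂)
open import Relation.Unary using (Pred; Decidable; _⊆′_)
open import Relation.Nullary using (¬_; Dec; yes; no; ¬?)
open import Relation.Nullary.Decidable as Dec using (decidable-stable)
open import Function.Bundles using (Equivalence)

missing-value⇒not-injective : ∀ {n} (f : Fin n → Fin n) (j : Fin n) → (∀ i → j ≢ f i) →
                               ∃₂ λ i i′ → i ≢ i′ × f i ≡ f i′
missing-value⇒not-injective {suc n} f j j≢f =
  let (i , i′ , i<i′ , eq) = Finₚ.pigeonhole (ℕₚ.n<1+n n) (λ i → punchOut (j≢f i)) in
  i , i′ , Finₚ.<⇒≢ i<i′ , Finₚ.punchOut-injective (j≢f i) (j≢f i′) eq

least : ∀ {n} {P : Pred (Fin n) 0ℓ} → Decidable P → ∀ {i} → P i →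
        Σ (Fin n) λ j → P j × (∀ {k} → P k → j Fin.≤ k)
least {suc n} P? Pi with P? zero
... | yes P0 = zero , P0 , λ _ → z≤n
least {suc n} P? {zero}  P0 | no ¬P0 = ⊥-elim (¬P0 P0)
least {suc n} P? {suc i} Pi | no ¬P0 =
  let (j , Pj , j-minimal) = least (λ k → P? (suc k)) Pi in
  suc j , Pj , λ { {zero} P0 → ⊥-elim (¬P0 P0) ; {suc k} Pk → s≤s (j-minimal Pk) }

n+n%2≡0 : ∀ q → (q ℕ.+ q) % 2 ≡ 0
n+n%2≡0 q =
  subst (λ m → m % 2 ≡ 0) (≡.trans (ℕₚ.*-comm q 2) (cong (q ℕ.+_) (ℕₚ.+-identityʳ q))) (DivMod.m*n%n≡0 q 2)

module _ (S : Setoid 0ℓ 0ℓ) where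
  open Setoid S using (_≈_; sym; trans; reflexive)
  open Membership S using (_∈_)

  lookup-injective : ∀ {xs} → Unique S xs → ∀ i j → lookup xs i ≈ lookup xs j → i ≡ j
  lookup-injective (_ ∷ _)         zero    zero    _  = refl
  lookup-injective {_ ∷ xs} (x≉ ∷ _) zero    (suc j) eq =
    ⊥-elim (All.All¬⇒¬Any x≉ (Membershipₚ.∈-resp-≈ S (sym eq) (Membershipₚ.∈-lookup S xs j)))
  lookup-injective {_ ∷ xs} (x≉ ∷ _) (suc i) zero    eq =
    ⊥-elim (All.All¬⇒¬Any x≉ (Membershipₚ.∈-resp-≈ S eq (Membershipₚ.∈-lookup S xs i)))
  lookup-injective (_ ∷ xs!)       (suc i) (suc j) eq = cong suc (lookup-injective xs! i j eq)

  index-cong : ∀ {xs x y} → Unique S xs → (p : x ∈ xs) (q : y ∈ xs) → x ≈ y → index p ≡ index q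
  index-cong xs! p q x≈y =
    lookup-injective xs! _ _ (trans (sym (lookup-index p)) (trans x≈y (lookup-index q)))

  length-mono : ∀ {xs ys} → Unique S xs → (∀ {x} → x ∈ xs → x ∈ ys) → length xs ≤ length ys
  length-mono {xs} {ys} xs! xs⊆ys = Finₚ.injective⇒≤ {f = position} λ {i} {j} eq →
    lookup-injective xs! i j
      (trans (lookup-index (at i)) (trans (reflexive (cong (lookup ys) eq)) (sym (lookup-index (at j)))))
    where
    at : ∀ i → lookup xs i ∈ ys
    at i = xs⊆ys (Membershipₚ.∈-lookup S xs i)
    position : Fin (length xs) → Fin (length ys)
    position i = index (at i)

module Counting (R : CommutativeRing 0ℓ 0ℓ) where
  open CommutativeRing R renaming (refl to ≈-refl)
  open import Algebra.Definitions _≈_ using (Congruent₁; Involutive)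

  private
    variable
      P Q : Pred Carrier 0ℓ
      x y : Carrier
      a b n : ℕ

  HasSize-mono : P ⊆′ Q → HasSize R P a → HasSize R Q b → a ≤ b
  HasSize-mono P⊆Q (xs , refl , xs! , Pxs , _) (ys , refl , _ , _ , ∈ys) = length-mono setoid xs! λ x∈xs →
    let (Py , x≈y) = All.lookupAny Pxs x∈xs in
    Membershipₚ.∈-resp-≈ setoid (sym x≈y) (∈ys _ (P⊆Q _ Py))

  HasSize-unique : P ⊆′ Q → Q ⊆′ P → HasSize R P a → HasSize R Q b → a ≡ b
  HasSize-unique P⊆Q Q⊆P |P| |Q| = ℕₚ.≤-antisym (HasSize-mono P⊆Q |P| |Q|) (HasSize-mono Q⊆P |Q| |P|)

  HasSize-filter : P Respects _≈_ → Decidable P → Card R n → ∃ (HasSize R P)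
  HasSize-filter resp P? (xs , _ , xs! , _ , ∈xs) =
    _ , filter P? xs , refl , Unique.filter⁺ setoid P? xs! , All.all-filter P? xs ,
    λ x Px → Membershipₚ.∈-filter⁺ setoid P? resp (∈xs x tt) Px

  HasSize-⊎ : P Respects _≈_ → (∀ x → P x → Q x → ⊥) → HasSize R P a → HasSize R Q b →
              HasSize R (λ x → P x ⊎ Q x) (a ℕ.+ b)
  HasSize-⊎ resp disjoint (xs , refl , xs! , Pxs , ∈xs) (ys , refl , ys! , Qys , ∈ys) =
    xs ++ ys , length-++ xs ,
    AllPairs.++⁺ xs! ys! (All.map (λ Px → All.map (λ Qy x≈y → disjoint _ (resp x≈y Px) Qy) Qys) Pxs) ,
    All.++⁺ (All.map inj₁ Pxs) (All.map inj₂ Qys) ,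
    λ { x (inj₁ Px) → Membershipₚ.∈-++⁺ˡ setoid (∈xs x Px)
      ; x (inj₂ Qx) → Membershipₚ.∈-++⁺ʳ setoid xs (∈ys x Qx) }

  HasSize-complement : P Respects _≈_ → Decidable P → Card R n → HasSize R P a →
                       HasSize R (λ x → ¬ P x) (n ∸ a)
  HasSize-complement {P} {n} {a} resp P? card |P| with HasSize-filter ¬P-resp (λ x → ¬? (P? x)) card
    where
    ¬P-resp : (λ x → ¬ P x) Respects _≈_
    ¬P-resp x≈y ¬Px Py = ¬Px (resp (sym x≈y) Py)
  ... | c , |¬P| = subst (HasSize R (λ x → ¬ P x)) (≡.sym n∸a≡c) |¬P|
    where
    n≡a+c : n ≡ a ℕ.+ c
    n≡a+c = HasSize-unique (λ x _ → Dec.toSum (P? x)) (λ _ _ → tt) card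
              (HasSize-⊎ resp (λ x Px ¬Px → ¬Px Px) |P| |¬P|)
    n∸a≡c : n ∸ a ≡ c
    n∸a≡c = ≡.trans (cong (_∸ a) n≡a+c) (ℕₚ.m+n∸m≡n a c)

  module _ {σ : Carrier → Carrier} (σ-cong : Congruent₁ σ) (σ-involutive : Involutive σ) where

    HasSize-involution : P Respects _≈_ → HasSize R P a → HasSize R (λ x → P (σ x)) a
    HasSize-involution resp (xs , refl , xs! , Pxs , ∈xs) =
      map σ xs , length-map σ xs ,
      Unique.map⁺ setoid setoid σ-injective xs! ,
      All.map⁺ (All.map (resp (sym (σ-involutive _))) Pxs) ,
      λ x Pσx → Membershipₚ.∈-resp-≈ setoid (σ-involutive x)
                  (Membershipₚ.∈-map⁺ setoid setoid σ-cong (∈xs (σ x) Pσx))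
      where
      σ-injective : ∀ {x y} → σ x ≈ σ y → x ≈ y
      σ-injective {x} {y} eq = trans (sym (σ-involutive x)) (trans (σ-cong eq) (σ-involutive y))

    HasSize-halves : Q Respects _≈_ → Decidable Q → (∀ x → Q x → Q (σ x) → ⊥) → Card R n →
                     Σ ℕ λ q → HasSize R Q q × HasSize R (λ x → Q x ⊎ Q (σ x)) (q ℕ.+ q)
    HasSize-halves resp Q? disjoint card =
      let (q , |Q|) = HasSize-filter resp Q? card in
      q , |Q| , HasSize-⊎ resp disjoint |Q| (HasSize-involution resp |Q|)


  position : Card R n → Carrier → Fin n
  position (xs , refl , _ , _ , ∈xs) x = index (∈xs x tt)

  element : Card R n → Fin n → Carrier
  element (xs , refl , _ , _ , _) = lookup xs

  position-cong : (card : Card R n) → x ≈ y → position card x ≡ position card y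
  position-cong (xs , refl , xs! , _ , ∈xs) = index-cong setoid xs! (∈xs _ tt) (∈xs _ tt)

  element-position : (card : Card R n) → element card (position card x) ≈ x
  element-position {x = x} (xs , refl , _ , _ , ∈xs) = sym (lookup-index (∈xs x tt))

  position-injective : (card : Card R n) → position card x ≡ position card y → x ≈ y
  position-injective card eq =
    trans (sym (element-position card)) (trans (reflexive (cong (element card) eq)) (element-position card))

  element-injective : (card : Card R n) → ∀ i j → element card i ≈ element card j → i ≡ j
  element-injective (xs , refl , xs! , _ , _) = lookup-injective setoid xs!

module Ideals (R : CommutativeRing 0ℓ 0ℓ) where
  open CommutativeRing R renaming (refl to ≈-refl)
  open Counting R
  open import Algebra.Properties.Ring ring using (-1*x≈-x)
  open import Algebra.Properties.CommutativeSemigroup +-commutativeSemigroup using (interchange)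

  private
    variable
      I M : Pred Carrier 0ℓ
      x y : Carrier
      a n : ℕ

  IsUnit-resp : x ≈ y → IsUnit R x → IsUnit R y
  IsUnit-resp x≈y (z , xz≈1) = z , trans (*-congʳ (sym x≈y)) xz≈1

  module _ (I-ideal : IsIdeal R I) where
    open IsIdeal I-ideal

    proper-ideal-nonunit : ¬ I 1# → I x → ¬ IsUnit R x
    proper-ideal-nonunit ¬I1 Ix (y , xy≈1) = ¬I1 (resp (trans (*-comm y _) xy≈1) (*-closed y Ix))

    ideal-neg : I x → I (- x)
    ideal-neg Ix = resp (-1*x≈-x _) (*-closed (- 1#) Ix)

  -- Maximality applied to the ideal M ∪ {z | P} decides P, so a maximal ideal
  -- in the sense of IsMaximalIdeal makes every proposition decidable.
  excluded-middle : IsMaximalIdeal R M → (P : Set) → Dec P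
  excluded-middle {M} (M-ideal , ¬M1 , M-maximal) P with M-maximal (λ z → M z ⊎ P) M∪P-ideal (λ _ → inj₁)
    where
    open IsIdeal M-ideal
    M∪P-ideal : IsIdeal R (λ z → M z ⊎ P)
    M∪P-ideal = record
      { resp     = λ { x≈y (inj₁ Mx) → inj₁ (resp x≈y Mx) ; _ (inj₂ p) → inj₂ p }
      ; zero∈    = inj₁ zero∈
      ; +-closed = λ { (inj₁ Mx) (inj₁ My) → inj₁ (+-closed Mx My)
                     ; (inj₂ p) _ → inj₂ p
                     ; _ (inj₂ p) → inj₂ p }
      ; *-closed = λ { r (inj₁ Mx) → inj₁ (*-closed r Mx) ; _ (inj₂ p) → inj₂ p }
      }
  ... | inj₁ (inj₁ M1) = ⊥-elim (¬M1 M1)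
  ... | inj₁ (inj₂ p)  = yes p
  ... | inj₂ M∪P⊆M     = no λ p → ¬M1 (M∪P⊆M 1# (inj₂ p))

  +-linear : ∀ i r j s x → (i + r * x) + (j + s * x) ≈ (i + j) + (r + s) * x
  +-linear i r j s x = trans (interchange i (r * x) j (s * x)) (+-congˡ (sym (distribʳ x r s)))

  *-linear : ∀ s i r x → s * (i + r * x) ≈ s * i + (s * r) * x
  *-linear s i r x = trans (distribˡ s i (r * x)) (+-congˡ (sym (*-assoc s r x)))

  _+⟨_⟩ : Pred Carrier 0ℓ → Carrier → Pred Carrier 0ℓ
  (I +⟨ x ⟩) z = ∃₂ λ i r → I i × z ≈ i + r * x

  ⊆-+⟨⟩ : I ⊆′ I +⟨ x ⟩
  ⊆-+⟨⟩ {x = x} i Ii = i , 0# , Ii , sym (trans (+-congˡ (zeroˡ x)) (+-identityʳ i))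

  module _ (I-ideal : IsIdeal R I) where
    open IsIdeal I-ideal

    +⟨⟩-isIdeal : IsIdeal R (I +⟨ x ⟩)
    +⟨⟩-isIdeal {x} = record
      { resp     = λ { z≈w (i , r , Ii , z≈) → i , r , Ii , trans (sym z≈w) z≈ }
      ; zero∈    = ⊆-+⟨⟩ 0# zero∈
      ; +-closed = λ { (i , r , Ii , z≈) (j , s , Ij , w≈) →
                       i + j , r + s , +-closed Ii Ij , trans (+-cong z≈ w≈) (+-linear i r j s x) }
      ; *-closed = λ { s (i , r , Ii , z≈) →
                       s * i , s * r , *-closed s Ii , trans (*-congˡ z≈) (*-linear s i r x) }
      }

    ∈-+⟨⟩ : (I +⟨ x ⟩) x
    ∈-+⟨⟩ {x} = 0# , 1# , zero∈ , sym (trans (+-identityˡ (1# * x)) (*-identityˡ x))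

  zero-isIdeal : IsIdeal R (_≈ 0#)
  zero-isIdeal = record
    { resp     = λ x≈y x≈0 → trans (sym x≈y) x≈0
    ; zero∈    = ≈-refl
    ; +-closed = λ x≈0 y≈0 → trans (+-cong x≈0 y≈0) (+-identityˡ 0#)
    ; *-closed = λ r x≈0 → trans (*-congˡ x≈0) (zeroʳ r)
    }

  principal-proper : ¬ IsUnit R y → ¬ ((_≈ 0#) +⟨ y ⟩) 1#
  principal-proper {y} ¬unit (i , r , i≈0 , 1≈) =
    ¬unit (r , trans (*-comm y r) (sym (trans 1≈ (trans (+-congʳ i≈0) (+-identityˡ (r * y))))))

  extension-grows : ∀ {b} → IsIdeal R I → ¬ I x → HasSize R I a → HasSize R (I +⟨ x ⟩) b → suc a ≤ b
  extension-grows {I = I} {x = x} {a = a} I-ideal ¬Ix |I| |I+x| =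
    ℕₚ.≤-trans (ℕₚ.≤-reflexive (ℕₚ.+-comm 1 a))
      (HasSize-mono I∪x⊆I+x (HasSize-⊎ {P = I} resp disjoint |I| |x|) |I+x|)
    where
    open IsIdeal I-ideal
    |x| : HasSize R (_≈ x) 1
    |x| = x ∷ [] , refl , [] ∷ [] , ≈-refl ∷ [] , λ _ y≈x → here y≈x
    disjoint : ∀ y → I y → y ≈ x → ⊥
    disjoint y Iy y≈x = ¬Ix (resp y≈x Iy)
    I∪x⊆I+x : (λ y → I y ⊎ y ≈ x) ⊆′ I +⟨ x ⟩
    I∪x⊆I+x y (inj₁ Iy)  = ⊆-+⟨⟩ {I = I} y Iy
    I∪x⊆I+x y (inj₂ y≈x) = IsIdeal.resp (+⟨⟩-isIdeal I-ideal) (sym y≈x) (∈-+⟨⟩ I-ideal)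

  module _ (dec : (P : Set) → Dec P) (card : Card R n) where

    maximal-or-extensible : IsIdeal R I → ¬ I 1# → IsMaximalIdeal R I ⊎ ∃ λ x → ¬ I x × ¬ (I +⟨ x ⟩) 1#
    maximal-or-extensible {I} I-ideal ¬I1 with dec (∃ λ x → ¬ I x × ¬ (I +⟨ x ⟩) 1#)
    ... | yes extensible = inj₂ extensible
    ... | no ¬extensible = inj₁ (I-ideal , ¬I1 , maximal)
      where
      maximal : ∀ J → IsIdeal R J → I ⊆′ J → J 1# ⊎ J ⊆′ I
      maximal J J-ideal I⊆J with dec (J 1#)
      ... | yes J1 = inj₁ J1
      ... | no ¬J1 = inj₂ λ x Jx → decidable-stable (dec (I x)) λ ¬Ix →
              ¬extensible (x , ¬Ix , λ (i , r , Ii , 1≈) →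
                ¬J1 (resp (sym 1≈) (+-closed (I⊆J i Ii) (*-closed r Jx))))
        where open IsIdeal J-ideal

    -- d is fuel: each extension adds an element, and R has only n of them.
    extend-to-maximal : ∀ d → IsIdeal R I → ¬ I 1# → HasSize R I a → n ≤ a ℕ.+ d →
                        Σ (Pred Carrier 0ℓ) λ M → IsMaximalIdeal R M × I ⊆′ M
    extend-to-maximal {I} {a} d I-ideal ¬I1 |I| n≤a+d with maximal-or-extensible I-ideal ¬I1
    ... | inj₁ I-maximal = I , I-maximal , λ _ Ix → Ix
    ... | inj₂ (x , ¬Ix , ¬I+x1) = extend d n≤a+d
      where
      I+x-ideal = +⟨⟩-isIdeal I-ideal {x}
      grown : ∃ (HasSize R (I +⟨ x ⟩))
      grown = HasSize-filter {P = I +⟨ x ⟩} (IsIdeal.resp I+x-ideal) (λ z → dec _) card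
      |I+x| = proj₂ grown
      a<|I+x| : suc a ≤ proj₁ grown
      a<|I+x| = extension-grows I-ideal ¬Ix |I| |I+x|
      extend : ∀ d → n ≤ a ℕ.+ d → Σ (Pred Carrier 0ℓ) λ M → IsMaximalIdeal R M × I ⊆′ M
      extend zero    n≤a+0 = ⊥-elim (ℕₚ.<⇒≱ a<|I+x|
        (ℕₚ.≤-trans (HasSize-mono {Q = λ _ → ⊤} (λ _ _ → tt) |I+x| card)
                    (subst (n ≤_) (ℕₚ.+-identityʳ a) n≤a+0)))
      extend (suc d) n≤a+1+d =
        let (M , M-maximal , I+x⊆M) = extend-to-maximal d I+x-ideal ¬I+x1 |I+x|
              (ℕₚ.≤-trans n≤a+1+d
                (subst (_≤ proj₁ grown ℕ.+ d) (≡.sym (ℕₚ.+-suc a d)) (ℕₚ.+-monoˡ-≤ d a<|I+x|)))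
        in M , M-maximal , λ z Iz → I+x⊆M z (⊆-+⟨⟩ {I = I} z Iz)

    nonunit∈maximal : ¬ IsUnit R y → Σ (Pred Carrier 0ℓ) λ M → IsMaximalIdeal R M × M y
    nonunit∈maximal {y} ¬unit =
      let (a , |⟨y⟩|) = HasSize-filter {P = (_≈ 0#) +⟨ y ⟩} (IsIdeal.resp ⟨y⟩-ideal) (λ z → dec _) card
          (M , M-maximal , ⟨y⟩⊆M) =
            extend-to-maximal n ⟨y⟩-ideal (principal-proper ¬unit) |⟨y⟩| (ℕₚ.m≤n+m n a)
      in M , M-maximal , ⟨y⟩⊆M y (∈-+⟨⟩ zero-isIdeal)
      where
      ⟨y⟩-ideal = +⟨⟩-isIdeal zero-isIdeal {y}

    local-nonunit∈M : IsLocalRing R → IsMaximalIdeal R M → ¬ IsUnit R y → M y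
    local-nonunit∈M {M} {y} (_ , _ , unique) M-maximal ¬unit =
      let (J , J-maximal , Jy) = nonunit∈maximal ¬unit in
      Equivalence.from (unique M M-maximal y) (Equivalence.to (unique J J-maximal y) Jy)

    local-¬M⇒unit : IsLocalRing R → IsMaximalIdeal R M → ¬ M x → IsUnit R x
    local-¬M⇒unit {x = x} local M-maximal ¬Mx with dec (IsUnit R x)
    ... | yes unit = unit
    ... | no ¬unit = ⊥-elim (¬Mx (local-nonunit∈M local M-maximal ¬unit))

module Parity (R : CommutativeRing 0ℓ 0ℓ) where
  open CommutativeRing R renaming (refl to ≈-refl)
  open Counting R
  open import Algebra.Properties.Ring ring using (+-cancelˡ; x∙y⁻¹≈ε⇒x≈y; x≈y⇒x∙y⁻¹≈ε; x[y-z]≈xy-xz)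

  private
    variable
      n : ℕ

  two : Carrier
  two = 1# + 1#

  two-* : ∀ x → two * x ≈ x + x
  two-* x = trans (distribʳ x 1# 1#) (+-cong (*-identityˡ x) (*-identityˡ x))

  nonunit-two⇒torsion : Card R n → ¬ IsUnit R two → ∃ λ t → ¬ t ≈ 0# × t + t ≈ 0#
  nonunit-two⇒torsion {n} card ¬unit =
    let (i , j , i≢j , eq) = missing-value⇒not-injective double (position card 1#) misses in
    element card i - element card j ,
    (λ t≈0 → i≢j (element-injective card i j (x∙y⁻¹≈ε⇒x≈y _ _ t≈0))) ,
    trans (sym (two-* _)) (trans (x[y-z]≈xy-xz two _ _) (x≈y⇒x∙y⁻¹≈ε (position-injective card eq)))
    where
    double : Fin n → Fin n
    double i = position card (two * element card i)
    misses : ∀ i → position card 1# ≢ double i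
    misses i eq = ¬unit (element card i , sym (position-injective card eq))

  torsion⇒even : {t : Carrier} → Card R n → ¬ t ≈ 0# → t + t ≈ 0# → ∃ λ q → n ≡ q ℕ.+ q
  torsion⇒even {t = t} card t≉0 t+t≈0 =
    let (q , _ , |L∪σL|) = HasSize-halves {σ = _+ t} +-congʳ involutive Lower-resp Lower? disjoint card in
    q , HasSize-unique (λ x _ → trichotomy x) (λ _ _ → tt) card |L∪σL|
    where
    involutive : ∀ x → (x + t) + t ≈ x
    involutive x = trans (+-assoc x t t) (trans (+-congˡ t+t≈0) (+-identityʳ x))
    Lower : Pred Carrier 0ℓ
    Lower x = position card x < position card (x + t)
    Lower-resp : Lower Respects _≈_
    Lower-resp x≈y = subst₂ _<_ (position-cong card x≈y) (position-cong card (+-congʳ x≈y))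
    Lower? : Decidable Lower
    Lower? x = position card x Finₚ.<? position card (x + t)
    disjoint : ∀ x → Lower x → Lower (x + t) → ⊥
    disjoint x x<x+t x+t<x =
      Finₚ.<-asym x<x+t (subst (position card (x + t) <_) (position-cong card (involutive x)) x+t<x)
    trichotomy : ∀ x → Lower x ⊎ Lower (x + t)
    trichotomy x with Finₚ.<-cmp (position card x) (position card (x + t))
    ... | tri< x<x+t _ _ = inj₁ x<x+t
    ... | tri≈ _ eq _      =
      ⊥-elim (t≉0 (sym (+-cancelˡ x 0# t (trans (+-identityʳ x) (position-injective card eq)))))
    ... | tri> _ _ x+t<x   =
      inj₂ (subst (position card (x + t) <_) (≡.sym (position-cong card (involutive x))) x+t<x)

  odd⇒two-unit : Card R n → n % 2 ≡ 1 → Dec (IsUnit R two) → IsUnit R two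
  odd⇒two-unit card odd (yes unit) = unit
  odd⇒two-unit card odd (no ¬unit) with nonunit-two⇒torsion card ¬unit
  ... | t , t≉0 , t+t≈0 with torsion⇒even card t≉0 t+t≈0
  ... | q , refl = ⊥-elim (ℕₚ.0≢1+n (≡.trans (≡.sym (n+n%2≡0 q)) odd))

Clash : ∀ {a b} → Fin a ⊎ Fin b → Fin a ⊎ Fin b → Set
Clash s t = ∃ λ j → s ≡ inj₁ j × t ≡ inj₁ j

-- For a local ring the single inj₁-colour is the class M and the inj₂-colours index H; in a
-- product the inj₁-colours record a coordinate lying in its maximal ideal. The strong conditions
-- on inj₁-classes and inj₂-vertices are what _⊗_ needs, `inhabited` supplying the inj₂-vertex
-- that fills the other factor's coordinate.
record CliqueColouring (S : CommutativeRing 0ℓ 0ℓ) (a b : ℕ) : Set where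
  open CommutativeRing S
  field
    colour        : Carrier → Fin a ⊎ Fin b
    colour-cong   : ∀ {x y} → x ≈ y → colour x ≡ colour y
    colour-inj₁   : ∀ {x y j} → colour x ≡ inj₁ j → colour y ≡ inj₁ j → ¬ IsUnit S (x + y)
    colour-inj₂   : ∀ {x y p} → colour x ≡ inj₂ p → colour y ≡ inj₂ p → IsUnit S (x + y) → x ≈ y
    vertex        : Fin a ⊎ Fin b → Carrier
    colour-vertex : ∀ s → colour (vertex s) ≡ s
    vertex-unit   : ∀ s t → ¬ Clash s t → IsUnit S (vertex s + vertex t)
    inhabited     : Fin b

module Local {R : CommutativeRing 0ℓ 0ℓ} {M : Pred (CommutativeRing.Carrier R) 0ℓ} {n k : ℕ}
  (M-maximal : IsMaximalIdeal R M) (local : IsLocalRing R)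
  (card : Card R n) (|M| : HasSize R M k) (two-unit : IsUnit R (Parity.two R))
  where
  open CommutativeRing R hiding (zero) renaming (refl to ≈-refl)
  open Counting R
  open Ideals R
  open Parity R using (two; two-*)
  open Membership setoid using (_∈_)
  open IsIdeal (proj₁ M-maximal) renaming (resp to M-resp; zero∈ to M0; +-closed to M+; *-closed to M*)
  open import Algebra.Properties.Ring ring
    using (-‿involutive; -‿injective; -‿+-comm; x≈y⇒x∙y⁻¹≈ε; ⁻¹-anti-homo‿-)

  dec : (P : Set) → Dec P
  dec = excluded-middle M-maximal

  ¬M⇒unit : ∀ {x} → ¬ M x → IsUnit R x
  ¬M⇒unit = local-¬M⇒unit dec card local M-maximal

  M⇒nonunit : ∀ {x} → M x → ¬ IsUnit R x
  M⇒nonunit = proper-ideal-nonunit (proj₁ M-maximal) (proj₁ (proj₂ M-maximal))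

  M-neg : ∀ {x} → M x → M (- x)
  M-neg = ideal-neg (proj₁ M-maximal)

  infix 4 _∼_
  _∼_ : Carrier → Carrier → Set
  x ∼ y = M (x - y)

  ≈⇒∼ : ∀ {x y} → x ≈ y → x ∼ y
  ≈⇒∼ x≈y = M-resp (sym (x≈y⇒x∙y⁻¹≈ε x≈y)) M0

  ∼-sym : ∀ {x y} → x ∼ y → y ∼ x
  ∼-sym {x} {y} x∼y = M-resp (⁻¹-anti-homo‿- x y) (M-neg x∼y)

  ∼-trans : ∀ {x y z} → x ∼ y → y ∼ z → x ∼ z
  ∼-trans {x} {y} {z} x∼y y∼z = M-resp telescope (M+ x∼y y∼z)
    where
    telescope : (x - y) + (y - z) ≈ x - z
    telescope = begin
      (x - y) + (y - z)   ≈⟨ +-assoc x (- y) (y - z) ⟩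
      x + (- y + (y - z)) ≈⟨ +-congˡ (+-assoc (- y) y (- z)) ⟨
      x + ((- y + y) - z) ≈⟨ +-congˡ (+-congʳ (-‿inverseˡ y)) ⟩
      x + (0# - z)        ≈⟨ +-congˡ (+-identityˡ (- z)) ⟩
      x - z               ∎
      where open import Relation.Binary.Reasoning.Setoid setoid

  InClassOf : Carrier → Pred (Fin n) 0ℓ
  InClassOf x i = ∃ λ y → position card y ≡ i × y ∼ x

  classRep : Carrier → Fin n
  classRep x = proj₁ (least (λ i → dec (InClassOf x i)) (x , refl , ≈⇒∼ ≈-refl))

  classRep-spec : ∀ x → InClassOf x (classRep x) × (∀ {i} → InClassOf x i → classRep x Fin.≤ i)
  classRep-spec x = proj₂ (least (λ i → dec (InClassOf x i)) (x , refl , ≈⇒∼ ≈-refl))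

  classRep-cong : ∀ {x y} → x ∼ y → classRep x ≡ classRep y
  classRep-cong {x} {y} x∼y = Finₚ.≤-antisym
    (proj₂ (classRep-spec x) (move (∼-sym x∼y) (proj₁ (classRep-spec y))))
    (proj₂ (classRep-spec y) (move x∼y (proj₁ (classRep-spec x))))
    where
    move : ∀ {x y i} → x ∼ y → InClassOf x i → InClassOf y i
    move x∼y (z , eq , z∼x) = z , eq , ∼-trans z∼x x∼y

  classRep-injective : ∀ {x y} → classRep x ≡ classRep y → x ∼ y
  classRep-injective {x} {y} eq with proj₁ (classRep-spec x) | proj₁ (classRep-spec y)
  ... | (x′ , x′-pos , x′∼x) | (y′ , y′-pos , y′∼y) =
    ∼-trans (∼-sym x′∼x)
      (∼-trans (≈⇒∼ (position-injective card (≡.trans x′-pos (≡.trans eq (≡.sym y′-pos))))) y′∼y)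

  -- Of the cosets x + M and - x + M, the one whose least element comes first in the
  -- enumeration of R is positive.
  Positive : Pred Carrier 0ℓ
  Positive x = ¬ M x × classRep x < classRep (- x)

  Positive-resp : Positive Respects _≈_
  Positive-resp x≈y (¬Mx , x<-x) =
    (λ My → ¬Mx (M-resp (sym x≈y) My)) ,
    subst₂ _<_ (classRep-cong (≈⇒∼ x≈y)) (classRep-cong (≈⇒∼ (-‿cong x≈y))) x<-x

  classRep-neg-neg : ∀ x → classRep (- (- x)) ≡ classRep x
  classRep-neg-neg x = classRep-cong (≈⇒∼ (-‿involutive x))

  ¬positive-and-negative : ∀ x → Positive x → Positive (- x) → ⊥
  ¬positive-and-negative x (_ , x<-x) (_ , -x<--x) =
    Finₚ.<-asym x<-x (subst (classRep (- x) <_) (classRep-neg-neg x) -x<--x)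

  -- Since 2 is a unit, x ∼ - x, i.e. 2x ∈ M, forces x ∈ M.
  positive-or-negative : ∀ {x} → ¬ M x → Positive x ⊎ Positive (- x)
  positive-or-negative {x} ¬Mx with Finₚ.<-cmp (classRep x) (classRep (- x))
  ... | tri< x<-x _ _ = inj₁ (¬Mx , x<-x)
  ... | tri≈ _ eq _   = ⊥-elim (¬Mx (halve (M-resp x+x≈2x (classRep-injective eq))))
    where
    x+x≈2x : x - - x ≈ two * x
    x+x≈2x = trans (+-congˡ (-‿involutive x)) (sym (two-* x))
    halve : M (two * x) → M x
    halve M2x = let (u , 2u≈1) = two-unit in
      M-resp (trans (sym (*-assoc u two x)) (trans (*-congʳ (trans (*-comm u two) 2u≈1)) (*-identityˡ x)))
             (M* u M2x)
  ... | tri> _ _ -x<x = inj₂ ((λ M-x → ¬Mx (M-resp (-‿involutive x) (M-neg M-x))) ,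
                              subst (classRep (- x) <_) (≡.sym (classRep-neg-neg x)) -x<x)

  positive-sum : ∀ {x y} → Positive x → Positive y → ¬ M (x + y)
  positive-sum {x} {y} (_ , x<-x) (_ , y<-y) Mx+y = Finₚ.<-asym
    (subst₂ _<_ (classRep-cong x∼-y) (classRep-cong -x∼y) x<-x) y<-y
    where
    x∼-y : x ∼ - y
    x∼-y = M-resp (+-congˡ (sym (-‿involutive y))) Mx+y
    -x∼y : - x ∼ y
    -x∼y = M-resp (sym (-‿+-comm x y)) (M-neg Mx+y)

  |Positive| : HasSize R Positive ⌊ (n ∸ k) /2⌋
  |Positive|
    with HasSize-halves -‿cong -‿involutive Positive-resp (λ x → dec (Positive x)) ¬positive-and-negative card
  ... | h , |P| , |P∪-P| = subst (HasSize R Positive) h≡⌊n∸k/2⌋ |P|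
    where
    n∸k≡h+h : n ∸ k ≡ h ℕ.+ h
    n∸k≡h+h = HasSize-unique (λ _ → positive-or-negative)
      (λ { x (inj₁ (¬Mx , _)) → ¬Mx ; x (inj₂ (¬M-x , _)) Mx → ¬M-x (M-neg Mx) })
      (HasSize-complement M-resp (λ x → dec (M x)) card |M|) |P∪-P|
    h≡⌊n∸k/2⌋ : h ≡ ⌊ (n ∸ k) /2⌋
    h≡⌊n∸k/2⌋ = ≡.trans (ℕₚ.n≡⌊n+n/2⌋ h) (cong ⌊_/2⌋ (≡.sym n∸k≡h+h))

  infix 4 _≈±_
  _≈±_ : Carrier → Carrier → Set
  x ≈± r = x ≈ r ⊎ x ≈ - r

  ≈±-respˡ : ∀ {x y r} → x ≈ y → y ≈± r → x ≈± r
  ≈±-respˡ x≈y (inj₁ y≈r)  = inj₁ (trans x≈y y≈r)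
  ≈±-respˡ x≈y (inj₂ y≈-r) = inj₂ (trans x≈y y≈-r)

  ≈±-sum : ∀ {x y r} → x ≈± r → y ≈± r → x ≈ y ⊎ x + y ≈ 0#
  ≈±-sum (inj₁ x≈r)  (inj₁ y≈r)  = inj₁ (trans x≈r (sym y≈r))
  ≈±-sum (inj₁ x≈r)  (inj₂ y≈-r) = inj₂ (trans (+-cong x≈r y≈-r) (-‿inverseʳ _))
  ≈±-sum (inj₂ x≈-r) (inj₁ y≈r)  = inj₂ (trans (+-cong x≈-r y≈r) (-‿inverseˡ _))
  ≈±-sum (inj₂ x≈-r) (inj₂ y≈-r) = inj₁ (trans x≈-r (sym y≈-r))

  ≈±-positive-unique : ∀ {x r r′} → Positive r → Positive r′ → x ≈± r → x ≈± r′ → r ≈ r′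
  ≈±-positive-unique _  _   (inj₁ x≈r)  (inj₁ x≈r′)  = trans (sym x≈r) x≈r′
  ≈±-positive-unique Pr Pr′ (inj₁ x≈r)  (inj₂ x≈-r′) =
    ⊥-elim (¬positive-and-negative _ Pr′ (Positive-resp (trans (sym x≈r) x≈-r′) Pr))
  ≈±-positive-unique Pr Pr′ (inj₂ x≈-r) (inj₁ x≈r′)  =
    ⊥-elim (¬positive-and-negative _ Pr (Positive-resp (trans (sym x≈r′) x≈-r) Pr′))
  ≈±-positive-unique _  _   (inj₂ x≈-r) (inj₂ x≈-r′) = -‿injective (trans (sym x≈-r) x≈-r′)

  representative : ∀ x → ¬ M x → Σ Carrier λ r → Positive r × x ≈± r
  representative x ¬Mx with positive-or-negative ¬Mx
  ... | inj₁ Px  = x , Px , inj₁ ≈-refl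
  ... | inj₂ P-x = - x , P-x , inj₂ (sym (-‿involutive x))

  module Halves (Hs : List Carrier) (Hs! : Unique setoid Hs) (Hs-positive : All Positive Hs)
                (∈Hs : ∀ x → Positive x → x ∈ Hs) where

    positive-lookup : ∀ i → Positive (lookup Hs i)
    positive-lookup i = All.lookupₛ setoid Positive-resp Hs-positive (Membershipₚ.∈-lookup setoid Hs i)

    slot : (x : Carrier) → ¬ M x → Fin (length Hs)
    slot x ¬Mx = let (r , Pr , _) = representative x ¬Mx in index (∈Hs r Pr)

    ≈±-slot : ∀ x ¬Mx → x ≈± lookup Hs (slot x ¬Mx)
    ≈±-slot x ¬Mx = let (r , Pr , x≈±r) = representative x ¬Mx in
      [ (λ x≈r → inj₁ (trans x≈r (lookup-index (∈Hs r Pr)))) ,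
        (λ x≈-r → inj₂ (trans x≈-r (-‿cong (lookup-index (∈Hs r Pr))))) ]′ x≈±r

    slot-unique : ∀ {x ¬Mx i} → x ≈± lookup Hs i → slot x ¬Mx ≡ i
    slot-unique {x} {¬Mx} {i} x≈±Hsᵢ = lookup-injective setoid Hs! _ _
      (≈±-positive-unique (positive-lookup _) (positive-lookup i) (≈±-slot x ¬Mx) x≈±Hsᵢ)

    slot-injective : ∀ {x y ¬Mx ¬My} → slot x ¬Mx ≡ slot y ¬My → IsUnit R (x + y) → x ≈ y
    slot-injective {x} {y} {¬Mx} {¬My} eq x+y-unit
      with ≈±-sum (subst (λ i → x ≈± lookup Hs i) eq (≈±-slot x ¬Mx)) (≈±-slot y ¬My)
    ... | inj₁ x≈y    = x≈y
    ... | inj₂ x+y≈0 = ⊥-elim (M⇒nonunit (M-resp (sym x+y≈0) M0) x+y-unit)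

    colourWith : ∀ x → Dec (M x) → Fin 1 ⊎ Fin (length Hs)
    colourWith x (yes _)   = inj₁ zero
    colourWith x (no ¬Mx) = inj₂ (slot x ¬Mx)

    colourWith-inj₁ : ∀ {x j} d → colourWith x d ≡ inj₁ j → M x
    colourWith-inj₁ (yes Mx) _ = Mx

    colourWith-inj₂ : ∀ {x i} d → colourWith x d ≡ inj₂ i → Σ (¬ M x) λ ¬Mx → slot x ¬Mx ≡ i
    colourWith-inj₂ (no ¬Mx) refl = ¬Mx , refl

    colourWith-cong : ∀ {x y} → x ≈ y → ∀ d d′ → colourWith x d ≡ colourWith y d′
    colourWith-cong x≈y (yes _)   (yes _)    = refl
    colourWith-cong x≈y (yes Mx)  (no ¬My)   = ⊥-elim (¬My (M-resp x≈y Mx))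
    colourWith-cong x≈y (no ¬Mx)  (yes My)   = ⊥-elim (¬Mx (M-resp (sym x≈y) My))
    colourWith-cong {x} {y} x≈y (no ¬Mx) (no ¬My) =
      cong inj₂ (≡.sym (slot-unique (≈±-respˡ (sym x≈y) (≈±-slot x ¬Mx))))

    vertex : Fin 1 ⊎ Fin (length Hs) → Carrier
    vertex (inj₁ _) = 0#
    vertex (inj₂ i) = lookup Hs i

    colourWith-vertex : ∀ s d → colourWith (vertex s) d ≡ s
    colourWith-vertex (inj₁ zero) (yes _)    = refl
    colourWith-vertex (inj₁ zero) (no ¬M0)   = ⊥-elim (¬M0 M0)
    colourWith-vertex (inj₂ i)    (yes MHsᵢ) = ⊥-elim (proj₁ (positive-lookup i) MHsᵢ)
    colourWith-vertex (inj₂ i)    (no _)     = cong inj₂ (slot-unique (inj₁ ≈-refl))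

    vertex-unit : ∀ s t → ¬ Clash s t → IsUnit R (vertex s + vertex t)
    vertex-unit (inj₁ zero) (inj₁ zero) ¬clash = ⊥-elim (¬clash (zero , refl , refl))
    vertex-unit (inj₁ _)    (inj₂ j)    _ =
      IsUnit-resp (sym (+-identityˡ _)) (¬M⇒unit (proj₁ (positive-lookup j)))
    vertex-unit (inj₂ i)    (inj₁ _)    _ =
      IsUnit-resp (sym (+-identityʳ _)) (¬M⇒unit (proj₁ (positive-lookup i)))
    vertex-unit (inj₂ i)    (inj₂ j)    _ = ¬M⇒unit (positive-sum (positive-lookup i) (positive-lookup j))

    certificate : CliqueColouring R 1 (length Hs)
    certificate = record
      { colour        = λ x → colourWith x (dec (M x))
      ; colour-cong   = λ {x} {y} x≈y → colourWith-cong x≈y (dec (M x)) (dec (M y))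
      ; colour-inj₁   = λ {x} {y} cx≡j cy≡j →
          M⇒nonunit (M+ (colourWith-inj₁ (dec (M x)) cx≡j) (colourWith-inj₁ (dec (M y)) cy≡j))
      ; colour-inj₂   = λ {x} {y} cx≡i cy≡i →
          let (_ , sx≡i) = colourWith-inj₂ (dec (M x)) cx≡i
              (_ , sy≡i) = colourWith-inj₂ (dec (M y)) cy≡i
          in slot-injective (≡.trans sx≡i (≡.sym sy≡i))
      ; vertex        = vertex
      ; colour-vertex = λ s → colourWith-vertex s (dec (M (vertex s)))
      ; vertex-unit   = vertex-unit
      ; inhabited     = slot 1# (proj₁ (proj₂ M-maximal))
      }

  certificate : CliqueColouring R 1 ⌊ (n ∸ k) /2⌋
  certificate = let (Hs , |Hs| , Hs! , Hs-positive , ∈Hs) = |Positive| in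
    subst (CliqueColouring R 1) |Hs| (Halves.certificate Hs Hs! Hs-positive ∈Hs)

module DirectProduct (S T : CommutativeRing 0ℓ 0ℓ) where
  private
    S×T = DP.commutativeRing S T

  IsUnit-× : ∀ {x y} → IsUnit S x → IsUnit T y → IsUnit S×T (x , y)
  IsUnit-× (x⁻¹ , xx⁻¹≈1) (y⁻¹ , yy⁻¹≈1) = (x⁻¹ , y⁻¹) , xx⁻¹≈1 , yy⁻¹≈1

  IsUnit-proj₁ : ∀ {z} → IsUnit S×T z → IsUnit S (proj₁ z)
  IsUnit-proj₁ ((x⁻¹ , _) , xx⁻¹≈1 , _) = x⁻¹ , xx⁻¹≈1

  IsUnit-proj₂ : ∀ {z} → IsUnit S×T z → IsUnit T (proj₂ z)
  IsUnit-proj₂ ((_ , y⁻¹) , _ , yy⁻¹≈1) = y⁻¹ , yy⁻¹≈1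

module Colours (a b c d : ℕ) where

  merge : Fin a ⊎ Fin b → Fin c ⊎ Fin d → Fin (a ℕ.+ c) ⊎ Fin (b ℕ.* d)
  merge (inj₁ j) _        = inj₁ (j ↑ˡ c)
  merge (inj₂ _) (inj₁ j) = inj₁ (a ↑ʳ j)
  merge (inj₂ p) (inj₂ q) = inj₂ (combine p q)

  left : Fin b → Fin (a ℕ.+ c) ⊎ Fin (b ℕ.* d) → Fin a ⊎ Fin b
  left p₀ (inj₁ k) = [ inj₁ , (λ _ → inj₂ p₀) ]′ (splitAt a k)
  left p₀ (inj₂ r) = inj₂ (proj₁ (remQuot {b} d r))

  right : Fin d → Fin (a ℕ.+ c) ⊎ Fin (b ℕ.* d) → Fin c ⊎ Fin d
  right q₀ (inj₁ k) = [ (λ _ → inj₂ q₀) , inj₁ ]′ (splitAt a k)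
  right q₀ (inj₂ r) = inj₂ (proj₂ (remQuot {b} d r))

  merge-left-right : ∀ p₀ q₀ s → merge (left p₀ s) (right q₀ s) ≡ s
  merge-left-right p₀ q₀ (inj₁ k) with splitAt a k in eq
  ... | inj₁ j = cong inj₁ (Finₚ.splitAt⁻¹-↑ˡ eq)
  ... | inj₂ j = cong inj₁ (Finₚ.splitAt⁻¹-↑ʳ eq)
  merge-left-right p₀ q₀ (inj₂ r) = cong inj₂ (Finₚ.combine-remQuot {b} d r)

  left-inj₁ : ∀ p₀ s {j} → left p₀ s ≡ inj₁ j → s ≡ inj₁ (j ↑ˡ c)
  left-inj₁ p₀ (inj₁ k) eq₁ with splitAt a k in eq
  left-inj₁ p₀ (inj₁ k) refl | inj₁ j = cong inj₁ (≡.sym (Finₚ.splitAt⁻¹-↑ˡ eq))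

  right-inj₁ : ∀ q₀ s {j} → right q₀ s ≡ inj₁ j → s ≡ inj₁ (a ↑ʳ j)
  right-inj₁ q₀ (inj₁ k) eq₁ with splitAt a k in eq
  right-inj₁ q₀ (inj₁ k) refl | inj₂ j = cong inj₁ (≡.sym (Finₚ.splitAt⁻¹-↑ʳ eq))

  merge-inj₁ : ∀ u v {k} → merge u v ≡ inj₁ k → [ (λ j → u ≡ inj₁ j) , (λ j → v ≡ inj₁ j) ]′ (splitAt a k)
  merge-inj₁ (inj₁ j) v        refl rewrite Finₚ.splitAt-↑ˡ a j c = refl
  merge-inj₁ (inj₂ p) (inj₁ j) refl rewrite Finₚ.splitAt-↑ʳ a c j = refl

  merge-inj₂ : ∀ u v {r} → merge u v ≡ inj₂ r →
               u ≡ inj₂ (proj₁ (remQuot {b} d r)) × v ≡ inj₂ (proj₂ (remQuot {b} d r))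
  merge-inj₂ (inj₂ p) (inj₂ q) refl =
    cong (λ pq → inj₂ (proj₁ pq)) (≡.sym (Finₚ.remQuot-combine p q)) ,
    cong (λ pq → inj₂ (proj₂ pq)) (≡.sym (Finₚ.remQuot-combine p q))

_⊗_ : ∀ {S T a b c d} → CliqueColouring S a b → CliqueColouring T c d →
      CliqueColouring (DP.commutativeRing S T) (a ℕ.+ c) (b ℕ.* d)
_⊗_ {S} {T} {a} {b} {c} {d} 𝒮 𝒯 = record
  { colour        = colour
  ; colour-cong   = λ (x₁≈y₁ , x₂≈y₂) → cong₂ merge (𝒮.colour-cong x₁≈y₁) (𝒯.colour-cong x₂≈y₂)
  ; colour-inj₁   = colour-inj₁
  ; colour-inj₂   = λ {x} {y} cx≡r cy≡r x+y-unit →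
      let (cx₁≡ , cx₂≡) = merge-inj₂ (𝒮.colour (proj₁ x)) (𝒯.colour (proj₂ x)) cx≡r
          (cy₁≡ , cy₂≡) = merge-inj₂ (𝒮.colour (proj₁ y)) (𝒯.colour (proj₂ y)) cy≡r
      in 𝒮.colour-inj₂ cx₁≡ cy₁≡ (IsUnit-proj₁ x+y-unit) ,
         𝒯.colour-inj₂ cx₂≡ cy₂≡ (IsUnit-proj₂ x+y-unit)
  ; vertex        = vertex
  ; colour-vertex = λ s → ≡.trans (cong₂ merge (𝒮.colour-vertex _) (𝒯.colour-vertex _))
                                  (merge-left-right 𝒮.inhabited 𝒯.inhabited s)
  ; vertex-unit   = λ s t ¬clash →
      IsUnit-× (𝒮.vertex-unit _ _ λ (j , sⱼ , tⱼ) → ¬clash (j ↑ˡ c , left-inj₁ _ s sⱼ , left-inj₁ _ t tⱼ))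
               (𝒯.vertex-unit _ _ λ (j , sⱼ , tⱼ) → ¬clash (a ↑ʳ j , right-inj₁ _ s sⱼ , right-inj₁ _ t tⱼ))
  ; inhabited     = combine 𝒮.inhabited 𝒯.inhabited
  }
  where
  module 𝒮 = CliqueColouring 𝒮
  module 𝒯 = CliqueColouring 𝒯
  open Colours a b c d
  open DirectProduct S T
  open CommutativeRing (DP.commutativeRing S T) using (Carrier; _+_)

  colour : Carrier → Fin (a ℕ.+ c) ⊎ Fin (b ℕ.* d)
  colour (x₁ , x₂) = merge (𝒮.colour x₁) (𝒯.colour x₂)

  colour-inj₁ : ∀ {x y k} → colour x ≡ inj₁ k → colour y ≡ inj₁ k →
                ¬ IsUnit (DP.commutativeRing S T) (x + y)
  colour-inj₁ {x₁ , x₂} {y₁ , y₂} {k} cx≡k cy≡k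
    with splitAt a k | merge-inj₁ (𝒮.colour x₁) (𝒯.colour x₂) cx≡k
                     | merge-inj₁ (𝒮.colour y₁) (𝒯.colour y₂) cy≡k
  ... | inj₁ j | cx₁≡j | cy₁≡j = λ x+y-unit → 𝒮.colour-inj₁ cx₁≡j cy₁≡j (IsUnit-proj₁ x+y-unit)
  ... | inj₂ j | cx₂≡j | cy₂≡j = λ x+y-unit → 𝒯.colour-inj₁ cx₂≡j cy₂≡j (IsUnit-proj₂ x+y-unit)

  vertex : Fin (a ℕ.+ c) ⊎ Fin (b ℕ.* d) → Carrier
  vertex s = 𝒮.vertex (left 𝒮.inhabited s) , 𝒯.vertex (right 𝒯.inhabited s)

trivial-certificate : CliqueColouring trivialRing 0 1
trivial-certificate = record
  { colour        = λ _ → inj₂ zero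
  ; colour-cong   = λ _ → refl
  ; colour-inj₁   = λ ()
  ; colour-inj₂   = λ _ _ _ → _
  ; vertex        = λ _ → _
  ; colour-vertex = λ { (inj₂ zero) → refl }
  ; vertex-unit   = λ _ _ _ → _ , _
  ; inhabited     = zero
  }

Π-certificate : ∀ m (R : Fin m → CommutativeRing 0ℓ 0ℓ) (h : Fin m → ℕ) →
                (∀ i → CliqueColouring (R i) 1 (h i)) → CliqueColouring (ΠRing m R) m (∏ m h)
Π-certificate zero    R h 𝒞 = trivial-certificate
Π-certificate (suc m) R h 𝒞 = 𝒞 zero ⊗ Π-certificate m (λ i → R (suc i)) (λ i → h (suc i)) (λ i → 𝒞 (suc i))

two-unit-component : ∀ m (R : Fin m → CommutativeRing 0ℓ 0ℓ) →
                     IsUnit (ΠRing m R) (Parity.two (ΠRing m R)) → ∀ i → IsUnit (R i) (Parity.two (R i))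
two-unit-component (suc m) R two-unit zero    = IsUnit-proj₁ two-unit
  where open DirectProduct (R zero) (ΠRing m (λ i → R (suc i)))
two-unit-component (suc m) R two-unit (suc i) =
  two-unit-component m (λ i → R (suc i)) (IsUnit-proj₂ two-unit) i
  where open DirectProduct (R zero) (ΠRing m (λ i → R (suc i)))

module _ {S : CommutativeRing 0ℓ 0ℓ} where
  open CommutativeRing S

  colouring-bounds-clique : ∀ {j c xs} → IsProperColouring S j c → IsClique S xs → length xs ≤ j
  colouring-bounds-clique {j} {c} {xs} (_ , proper) clique = begin
    length xs          ≡⟨ length-map c xs ⟨
    length (map c xs)  ≤⟨ length-mono (≡.setoid (Fin j)) distinct-colours (λ {i} _ → ∈-allFin i) ⟩
    length (allFin j)  ≡⟨ length-tabulate (λ i → i) ⟩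
    j                  ∎
    where
    open ℕₚ.≤-Reasoning
    distinct-colours : Unique (≡.setoid (Fin j)) (map c xs)
    distinct-colours = AllPairs.map⁺ (AllPairs.map (λ {x} {y} → proper x y) clique)

  clique-and-colouring : ∀ {K c xs} → IsClique S xs → length xs ≡ K → IsProperColouring S K c →
                         IsCliqueNumber S K × IsChromaticNumber S K
  clique-and-colouring {K} {c} {xs} clique |xs|≡K proper =
    ((xs , clique , |xs|≡K) , λ ys ys-clique → colouring-bounds-clique proper ys-clique) ,
    ((c , proper) , λ j c′ proper′ → subst (_≤ j) |xs|≡K (colouring-bounds-clique proper′ clique))

  certificate⇒ω≡χ : ∀ {a b} → CliqueColouring S a b →
                    IsCliqueNumber S (a ℕ.+ b) × IsChromaticNumber S (a ℕ.+ b)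
  certificate⇒ω≡χ {a} {b} 𝒞 = clique-and-colouring (AllPairs.tabulate⁺ adjacent) (length-tabulate v)
    ((λ x y x≈y → cong (join a b) (colour-cong x≈y)) , proper)
    where
    open CliqueColouring 𝒞
    v : Fin (a ℕ.+ b) → Carrier
    v i = vertex (splitAt a i)
    split-injective : ∀ {i j} → splitAt a i ≡ splitAt a j → i ≡ j
    split-injective {i} {j} eq =
      ≡.trans (≡.sym (Finₚ.join-splitAt a b i)) (≡.trans (cong (join a b) eq) (Finₚ.join-splitAt a b j))
    adjacent : ∀ {i j} → i ≢ j → UAdj S (v i) (v j)
    adjacent {i} {j} i≢j =
      (λ vᵢ≈vⱼ → i≢j (split-injective
         (≡.trans (≡.sym (colour-vertex _)) (≡.trans (colour-cong vᵢ≈vⱼ) (colour-vertex _))))) ,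
      vertex-unit _ _ λ (_ , sᵢ , sⱼ) → i≢j (split-injective (≡.trans sᵢ (≡.sym sⱼ)))
    join-injective : ∀ {s t} → join a b s ≡ join a b t → s ≡ t
    join-injective {s} {t} eq =
      ≡.trans (≡.sym (Finₚ.splitAt-join a b s)) (≡.trans (cong (splitAt a) eq) (Finₚ.splitAt-join a b t))
    proper : ∀ x y → UAdj S x y → join a b (colour x) ≢ join a b (colour y)
    proper x y (x≉y , x+y-unit) eq with colour x in cx
    ... | inj₁ j = colour-inj₁ cx (≡.sym (join-injective eq)) x+y-unit
    ... | inj₂ p = x≉y (colour-inj₂ cx (≡.sym (join-injective eq)) x+y-unit)

open import Data.Nat using (_+_)

theorem1 : (m : ℕ) (R : Fin m → CommutativeRing 0ℓ 0ℓ)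
    → (∀ i → IsLocalRing (R i))
    → (M : (i : Fin m) → CommutativeRing.Carrier (R i) → Set)
    → (∀ i → IsMaximalIdeal (R i) (M i))
    → (n k : Fin m → ℕ)
    → (∀ i → Card (R i) (n i))
    → (∀ i → HasSize (R i) (M i) (k i))
    → (N : ℕ) → Card (ΠRing m R) N → N % 2 ≡ 1
    → IsCliqueNumber (ΠRing m R) (m + ∏ m (λ i → ⌊ (n i ∸ k i) /2⌋))
      × IsChromaticNumber (ΠRing m R) (m + ∏ m (λ i → ⌊ (n i ∸ k i) /2⌋))
theorem1 m R local M M-maximal n k card |M| N card-Π odd =
  certificate⇒ω≡χ (Π-certificate m R (λ i → ⌊ (n i ∸ k i) /2⌋) λ i →
    Local.certificate (M-maximal i) (local i) (card i) (|M| i) (two-unit i))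
  where
  two-unit : ∀ i → IsUnit (R i) (Parity.two (R i))
  two-unit i = two-unit-component m R
    (Parity.odd⇒two-unit (ΠRing m R) card-Π odd (Ideals.excluded-middle (R i) (M-maximal i) _)) i
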